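{- Let $X=\{x,y,z\}$, $N=\{1,\dots,n\}$ with $n\ge 3$, and let $g:NP\to X$ be strategy-proof. For $j\in\{1,2,3,4\}$ define profiles $Lj^{*}$ as follows (individuals $3,\dots,n-2$, if any, all have $z\succ y\succ x$ in every $Lj^{*}$): $L1^{*}$: individuals $1,2$ have $z\succ x\succ y$, individual $n-1$ has $z\succ y\succ x$, individual $n$ has $y\succ x\succ z$; $L2^{*}$: individual $1$ has $y\succ z\succ x$, individual $2$ has $z\succ x\succ y$, individual $n-1$ has $x\succ z\succ y$, individual $n$ has $z\succ x\succ y$; $L3^{*}$: individual $1$ has $z\succ y\succ x$, individual $2$ has $z\succ x\succ y$, individual $n-1$ has $x\succ y\succ z$, individual $n$ has $z\succ x\succ y$; $L4^{*}$: individuals $1,2$ have $z\succ x\succ y$, individual $n-1$ has $x\succ z\succ y$, individual $n$ has $y\succ z\succ x$. Let $Lj^{**}$ be the profile obtained from $Lj^{*}$ by changing the ordering of each individual $3,\dots,n-2$ from $z\succ y\succ x$ to $y\succ z\succ x$, all other orderings unchanged. Then for each $j\in\{1,2,3,4\}$, $g(Lj^{**})=x$ implies $g(Lj^{*})=x$.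
   Context: A profile is a map $p:N\to L(X)$, where $L(X)$ is the set of strict linear orderings of $X$; write $a\succ_{p(i)}b$ if individual $i$ strictly prefers $a$ to $b$ at $p$. $NP$ is the set of all profiles $p$ such that for every pair of distinct alternatives $a,b$ there exist individuals $i,j$ with $a\succ_{p(i)}b$ and $b\succ_{p(j)}a$. Two profiles $p,q$ are $h$-variants if $q(i)=p(i)$ for all $i\neq h$. A rule $g:NP\to X$ is strategy-proof if there are no $h\in N$ and $h$-variants $p,p'\in NP$ with $g(p')\succ_{p(h)}g(p)$. -}

module Defs where

open import Data.Nat using (ℕ; zero; suc; _∸_; _<_)
open import Data.Nat.Properties using (_≟_)
open import Data.Fin as Fin using (Fin; toℕ)
open import Data.Product using (∃₂; _×_)
open import Relation.Nullary using (¬_; yes; no)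
open import Relation.Binary.PropositionalEquality using (_≡_; _≢_)

data X : Set where
  x y z : X

-- Strict linear orderings of X, written best-to-worst:
-- e.g. zxy is the ordering z ≻ x ≻ y.  There are exactly 3! = 6 of them.
data LX : Set where
  xyz xzy yxz yzx zxy zyx : LX

-- position of an alternative in an ordering (0 = best)
rank : LX → X → ℕ
rank xyz x = 0
rank xyz y = 1
rank xyz z = 2
rank xzy x = 0
rank xzy z = 1
rank xzy y = 2
rank yxz y = 0
rank yxz x = 1
rank yxz z = 2
rank yzx y = 0
rank yzx z = 1
rank yzx x = 2
rank zxy z = 0
rank zxy x = 1
rank zxy y = 2
rank zyx z = 0
rank zyx y = 1
rank zyx x = 2

_≻[_]_ : X → LX → X → Set
a ≻[ o ] b = rank o a < rank o b

-- Individuals N = {1,…,n} are represented by Fin n (individual k ↦ index k-1).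
Profile : ℕ → Set
Profile n = Fin n → LX

NP : ∀ {n} → Profile n → Set
NP {n} p = ∀ (a b : X) → a ≢ b → ∃₂ λ (i j : Fin n) → (a ≻[ p i ] b) × (b ≻[ p j ] a)

Variant : ∀ {n} → Fin n → Profile n → Profile n → Set
Variant {n} h p q = ∀ (i : Fin n) → i ≢ h → q i ≡ p i

-- a rule g : NP → X (the NP-proof is irrelevant, so g depends only on the profile)
Rule : ℕ → Set
Rule n = (p : Profile n) → .(NP p) → X

StrategyProof : ∀ {n} → Rule n → Set
StrategyProof {n} g =
  ∀ (h : Fin n) (p p' : Profile n) (np : NP p) (np' : NP p') →
  Variant h p p' → ¬ (g p' np' ≻[ p h ] g p np)

data Role : Set where
  first second penult last middle : Role

role : (n : ℕ) → Fin n → Role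
role n i with toℕ i
... | 0 = first
... | 1 = second
... | suc (suc k) with suc (suc k) ≟ n ∸ 2
...   | yes _ = penult
...   | no _ with suc (suc k) ≟ n ∸ 1
...     | yes _ = last
...     | no _ = middle

-- the orderings in Lj* (j = 1,2,3,4 represented by Fin 4 index j-1)
starOrd : Fin 4 → Role → LX
starOrd _ middle = zyx
starOrd Fin.zero first = zxy
starOrd Fin.zero second = zxy
starOrd Fin.zero penult = zyx
starOrd Fin.zero last = yxz
starOrd (Fin.suc Fin.zero) first = yzx
starOrd (Fin.suc Fin.zero) second = zxy
starOrd (Fin.suc Fin.zero) penult = xzy
starOrd (Fin.suc Fin.zero) last = zxy
starOrd (Fin.suc (Fin.suc Fin.zero)) first = zyx
starOrd (Fin.suc (Fin.suc Fin.zero)) second = zxy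
starOrd (Fin.suc (Fin.suc Fin.zero)) penult = xyz
starOrd (Fin.suc (Fin.suc Fin.zero)) last = zxy
starOrd (Fin.suc (Fin.suc (Fin.suc Fin.zero))) first = zxy
starOrd (Fin.suc (Fin.suc (Fin.suc Fin.zero))) second = zxy
starOrd (Fin.suc (Fin.suc (Fin.suc Fin.zero))) penult = xzy
starOrd (Fin.suc (Fin.suc (Fin.suc Fin.zero))) last = yzx

starstarOrd : Fin 4 → Role → LX
starstarOrd j middle = yzx
starstarOrd j r = starOrd j r

Lstar : (n : ℕ) → Fin 4 → Profile n
Lstar n j i = starOrd j (role n i)

Lstarstar : (n : ℕ) → Fin 4 → Profile n
Lstarstar n j i = starstarOrd j (role n i)

module Submission where

-- Lj* arises from Lj** by letting the individuals 3,…,n-2, who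
-- rank x last in Lj** (ordering y ≻ z ≻ x), switch to z ≻ y ≻ x.  A
-- strategy-proof rule cannot move away from an alternative a when a single
-- voter who ranks a last changes his ballot (else he would gain by that
-- change), nor when a voter re-submits the same ballot.  Changing the voters
-- one at a time along the "hybrid" profiles between Lj** and Lj* therefore
-- keeps x chosen, provided every hybrid lies in NP; this holds because the
-- individuals 1, 2, n-1, n never change and already disagree on every pair.

open import Defs
open import Data.Nat using (ℕ; zero; suc; _+_; _≤_; _<_; _∸_; _<ᵇ_; s≤s)
open import Data.Nat.Properties
  using (<-cmp; ≟-diag; n<1+n; m<n⇒m<1+n; <⇒≤; ≤-refl; <⇒<ᵇ; 1+n≢n; _<?_)
  renaming (_≟_ to _≟ℕ_)
open import Data.Fin using (Fin; toℕ; fromℕ<; #_)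
open import Data.Fin.Properties using (toℕ-fromℕ<; toℕ-injective; toℕ<n)
open import Data.Bool using (true; false; if_then_else_)
open import Data.Bool.Properties using (T-≡)
open import Data.Product using (∃₂; _×_; _,_; proj₁; proj₂)
open import Data.Sum using (_⊎_; inj₁; inj₂)
open import Data.Empty using (⊥-elim)
open import Function using (_∘_)
open import Function.Bundles using (Equivalence)
open import Relation.Binary using (tri<; tri≈; tri>)
open import Relation.Binary.Definitions using (DecidableEquality)
open import Relation.Nullary using (yes; no)
open import Relation.Nullary.Decidable using (True; toWitness; map′; dec-no)
open import Relation.Binary.PropositionalEquality
  using (_≡_; _≢_; refl; sym; trans; cong; subst)

listing : LX → X × X × X
listing xyz = x , y , z
listing xzy = x , z , y
listing yxz = y , x , z
listing yzx = y , z , x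
listing zxy = z , x , y
listing zyx = z , y , x

at : LX → ℕ → X
at o 0 = proj₁ (listing o)
at o 1 = proj₁ (proj₂ (listing o))
at o _ = proj₂ (proj₂ (listing o))

at-rank : ∀ o a → at o (rank o a) ≡ a
at-rank xyz x = refl
at-rank xyz y = refl
at-rank xyz z = refl
at-rank xzy x = refl
at-rank xzy y = refl
at-rank xzy z = refl
at-rank yxz x = refl
at-rank yxz y = refl
at-rank yxz z = refl
at-rank yzx x = refl
at-rank yzx y = refl
at-rank yzx z = refl
at-rank zxy x = refl
at-rank zxy y = refl
at-rank zxy z = refl
at-rank zyx x = refl
at-rank zyx y = refl
at-rank zyx z = refl

rank-injective : ∀ o {a b} → rank o a ≡ rank o b → a ≡ b
rank-injective o {a} {b} same =
  trans (sym (at-rank o a)) (trans (cong (at o) same) (at-rank o b))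

_≟ₓ_ : DecidableEquality X
a ≟ₓ b = map′ (rank-injective xyz) (cong (rank xyz)) (rank xyz a ≟ℕ rank xyz b)

≻-connex : ∀ o {a b} → a ≢ b → (a ≻[ o ] b) ⊎ (b ≻[ o ] a)
≻-connex o {a} {b} a≢b with <-cmp (rank o a) (rank o b)
... | tri< a≻b _ _ = inj₁ a≻b
... | tri≈ _ same _ = ⊥-elim (a≢b (rank-injective o same))
... | tri> _ _ b≻a = inj₂ b≻a

Worst : LX → X → Set
Worst o a = ∀ b → b ≢ a → b ≻[ o ] a

Variant-sym : ∀ {n} {h : Fin n} {p q : Profile n} → Variant h p q → Variant h q p
Variant-sym v i i≢h = sym (v i i≢h)

module StrategyProofRule {n : ℕ} (g : Rule n) (sp : StrategyProof g) where

  -- If the deviating voter ranks the chosen a last, a stays chosen: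
  -- otherwise the deviation would strictly benefit him.
  worst-stays : ∀ {h p p' a} (np : NP p) (np' : NP p') → Variant h p p' →
    Worst (p h) a → g p np ≡ a → g p' np' ≡ a
  worst-stays {h} {p} {p'} {a} np np' v worst chosen with g p' np' ≟ₓ a
  ... | yes stays = stays
  ... | no moved = ⊥-elim (sp h p p' np np' v
          (subst (λ c → g p' np' ≻[ p h ] c) (sym chosen) (worst _ moved)))

  -- Re-submitting the same ballot cannot change the outcome: whichever
  -- outcome the voter prefers, he could reach it from the other profile.
  same-ballot : ∀ {h p p'} (np : NP p) (np' : NP p') → Variant h p p' →
    p' h ≡ p h → g p np ≡ g p' np'
  same-ballot {h} {p} {p'} np np' v same with g p np ≟ₓ g p' np'
  ... | yes equal = equal
  ... | no differ with ≻-connex (p h) differ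
  ...   | inj₁ old≻new = ⊥-elim (sp h p' p np' np (Variant-sym v)
            (subst (λ o → g p np ≻[ o ] g p' np') (sym same) old≻new))
  ...   | inj₂ new≻old = ⊥-elim (sp h p p' np np' v new≻old)

  -- Voter-wise equal profiles have the same outcome (NP supplies a voter).
  pointwise-outcome : ∀ {p p'} (np : NP p) (np' : NP p') →
    (∀ i → p' i ≡ p i) → g p np ≡ g p' np'
  pointwise-outcome np np' equal =
    same-ballot np np' (λ i _ → equal i) (equal (proj₁ (np x y λ ())))

  harmless-step : ∀ {h p p' a} (np : NP p) (np' : NP p') → Variant h p p' →
    p' h ≡ p h ⊎ Worst (p h) a → g p np ≡ a → g p' np' ≡ a
  harmless-step np np' v (inj₁ same) chosen = trans (sym (same-ballot np np' v same)) chosen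
  harmless-step np np' v (inj₂ worst) chosen = worst-stays np np' v worst chosen

hybrid : ∀ {n} → Profile n → Profile n → ℕ → Profile n
hybrid p p' k i = if toℕ i <ᵇ k then p' i else p i

<ᵇ-suc : ∀ {m k} → m ≢ k → (m <ᵇ suc k) ≡ (m <ᵇ k)
<ᵇ-suc {zero} {zero} m≢k = ⊥-elim (m≢k refl)
<ᵇ-suc {zero} {suc k} _ = refl
<ᵇ-suc {suc m} {zero} _ = refl
<ᵇ-suc {suc m} {suc k} m≢k = <ᵇ-suc (m≢k ∘ cong suc)

<ᵇ-irrefl : ∀ k → (k <ᵇ k) ≡ false
<ᵇ-irrefl zero = refl
<ᵇ-irrefl (suc k) = <ᵇ-irrefl k

<⇒<ᵇ≡true : ∀ {m n} → m < n → (m <ᵇ n) ≡ true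
<⇒<ᵇ≡true = Equivalence.to T-≡ ∘ <⇒<ᵇ

module _ {n : ℕ} (p p' : Profile n) where

  hybrid-variant : ∀ {k} (h : Fin n) → toℕ h ≡ k →
    Variant h (hybrid p p' k) (hybrid p p' (suc k))
  hybrid-variant h refl i i≢h =
    cong (λ b → if b then p' i else p i) (<ᵇ-suc (i≢h ∘ toℕ-injective))

  hybrid-switch : ∀ {k} (h : Fin n) → toℕ h ≡ k →
    hybrid p p' k h ≡ p h × hybrid p p' (suc k) h ≡ p' h
  hybrid-switch {k} h refl =
      cong (λ b → if b then p' h else p h) (<ᵇ-irrefl k)
    , cong (λ b → if b then p' h else p h) (<⇒<ᵇ≡true (n<1+n k))

  hybrid-end : ∀ i → hybrid p p' n i ≡ p' i
  hybrid-end i = cong (λ b → if b then p' i else p i) (<⇒<ᵇ≡true (toℕ<n i))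

OnlyWorstChange : ∀ {n} → X → Profile n → Profile n → Set
OnlyWorstChange a p p' = ∀ i → p' i ≡ p i ⊎ Worst (p i) a

module Monotonicity {n : ℕ} (g : Rule n) (sp : StrategyProof g) where
  open StrategyProofRule g sp

  module _ {a : X} {p p' : Profile n} (changes : OnlyWorstChange a p p')
           (np : ∀ k → NP (hybrid p p' k)) where

    hybrid-outcome : g p (np 0) ≡ a → ∀ k → k ≤ n → g (hybrid p p' k) (np k) ≡ a
    hybrid-outcome chosen zero _ = chosen
    hybrid-outcome chosen (suc k) k<n =
      harmless-step (np k) (np (suc k)) (hybrid-variant p p' h h≡k) switch
        (hybrid-outcome chosen k (<⇒≤ k<n))
      where
      h : Fin n
      h = fromℕ< k<n
      h≡k : toℕ h ≡ k
      h≡k = toℕ-fromℕ< k<n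
      switch : hybrid p p' (suc k) h ≡ hybrid p p' k h ⊎ Worst (hybrid p p' k h) a
      switch with hybrid-switch p p' h h≡k
      ... | before , after rewrite before | after = changes h

    monotonicity : (np* : NP p') → g p (np 0) ≡ a → g p' np* ≡ a
    monotonicity np* chosen =
      trans (sym (pointwise-outcome (np n) np* (sym ∘ hybrid-end p p')))
            (hybrid-outcome chosen n ≤-refl)

Splits : ∀ {n} → Profile n → X → X → Set
Splits {n} p a b = ∃₂ λ (i j : Fin n) → (a ≻[ p i ] b) × (b ≻[ p j ] a)

NP-from-pairs : ∀ {n} {p : Profile n} →
  Splits p x y → Splits p x z → Splits p y z → NP p
NP-from-pairs _ _ _ x x x≢x = ⊥-elim (x≢x refl)
NP-from-pairs xy _ _ x y _ = xy
NP-from-pairs _ xz _ x z _ = xz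
NP-from-pairs (i , j , u , v) _ _ y x _ = j , i , v , u
NP-from-pairs _ _ _ y y y≢y = ⊥-elim (y≢y refl)
NP-from-pairs _ _ yz y z _ = yz
NP-from-pairs _ (i , j , u , v) _ z x _ = j , i , v , u
NP-from-pairs _ _ (i , j , u , v) z y _ = j , i , v , u
NP-from-pairs _ _ _ z z z≢z = ⊥-elim (z≢z refl)

NP-embed : ∀ {m n} {p : Profile m} {q : Profile n} (e : Fin m → Fin n) →
  (∀ i → q (e i) ≡ p i) → NP p → NP q
NP-embed e same np a b a≢b with np a b a≢b
... | i , j , u , v =
  e i , e j , subst (λ o → a ≻[ o ] b) (sym (same i)) u
            , subst (λ o → b ≻[ o ] a) (sym (same j)) v

<-by-eval : ∀ {m n} {ok : True (m <? n)} → m < n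
<-by-eval {ok = ok} = toWitness ok

L4-NP : ∀ j → NP (Lstar 4 j)
L4-NP Fin.zero = NP-from-pairs
  (# 0 , # 2 , <-by-eval , <-by-eval)
  (# 3 , # 0 , <-by-eval , <-by-eval)
  (# 3 , # 0 , <-by-eval , <-by-eval)
L4-NP (Fin.suc Fin.zero) = NP-from-pairs
  (# 2 , # 0 , <-by-eval , <-by-eval)
  (# 2 , # 1 , <-by-eval , <-by-eval)
  (# 0 , # 1 , <-by-eval , <-by-eval)
L4-NP (Fin.suc (Fin.suc Fin.zero)) = NP-from-pairs
  (# 1 , # 0 , <-by-eval , <-by-eval)
  (# 2 , # 1 , <-by-eval , <-by-eval)
  (# 2 , # 1 , <-by-eval , <-by-eval)
L4-NP (Fin.suc (Fin.suc (Fin.suc Fin.zero))) = NP-from-pairs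
  (# 0 , # 3 , <-by-eval , <-by-eval)
  (# 2 , # 0 , <-by-eval , <-by-eval)
  (# 3 , # 0 , <-by-eval , <-by-eval)

starstar-change : ∀ j r → starOrd j r ≡ starstarOrd j r ⊎ Worst (starstarOrd j r) x
starstar-change j first = inj₁ refl
starstar-change j second = inj₁ refl
starstar-change j penult = inj₁ refl
starstar-change j last = inj₁ refl
starstar-change j middle = inj₂ yzx-worst
  where
  yzx-worst : Worst yzx x
  yzx-worst x x≢x = ⊥-elim (x≢x refl)
  yzx-worst y _ = <-by-eval
  yzx-worst z _ = <-by-eval

hybrid-off-middle : ∀ {n} j k (i : Fin n) → role n i ≢ middle →
  hybrid (Lstarstar n j) (Lstar n j) k i ≡ Lstar n j i
hybrid-off-middle {n} j k i off with toℕ i <ᵇ k | role n i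
... | true | _ = refl
... | false | first = refl
... | false | second = refl
... | false | penult = refl
... | false | last = refl
... | false | middle = ⊥-elim (off refl)

role-penult : ∀ {n} (i : Fin n) k → toℕ i ≡ 2 + k → 2 + k ≡ n ∸ 2 → role n i ≡ penult
role-penult i k i≡ pen with toℕ i | i≡
... | _ | refl rewrite ≟-diag pen = refl

role-last : ∀ {n} (i : Fin n) k → toℕ i ≡ 2 + k → 2 + k ≢ n ∸ 2 → 2 + k ≡ n ∸ 1 →
  role n i ≡ last
role-last {n} i k i≡ not-pen lst with toℕ i | i≡
... | _ | refl rewrite dec-no (2 + k ≟ℕ n ∸ 2) not-pen | ≟-diag lst = refl

-- The individuals 1, 2, n-1, n of a society of size n = 4 + m.
frame : ∀ m → Fin 4 → Fin (4 + m)
frame m Fin.zero = Fin.zero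
frame m (Fin.suc Fin.zero) = Fin.suc Fin.zero
frame m (Fin.suc (Fin.suc Fin.zero)) = fromℕ< (m<n⇒m<1+n (n<1+n (2 + m)))
frame m (Fin.suc (Fin.suc (Fin.suc Fin.zero))) = fromℕ< (n<1+n (3 + m))

frame-role : ∀ m i → role (4 + m) (frame m i) ≡ role 4 i
frame-role m Fin.zero = refl
frame-role m (Fin.suc Fin.zero) = refl
frame-role m (Fin.suc (Fin.suc Fin.zero)) =
  role-penult (frame m (# 2)) m (toℕ-fromℕ< (m<n⇒m<1+n (n<1+n (2 + m)))) refl
frame-role m (Fin.suc (Fin.suc (Fin.suc Fin.zero))) =
  role-last (frame m (# 3)) (suc m) (toℕ-fromℕ< (n<1+n (3 + m))) 1+n≢n refl

hybrid-NP : ∀ m j k → NP (hybrid (Lstarstar (4 + m) j) (Lstar (4 + m) j) k)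
hybrid-NP m j k = NP-embed (frame m) agree (L4-NP j)
  where
  off-middle : ∀ i → role 4 i ≢ middle
  off-middle Fin.zero ()
  off-middle (Fin.suc Fin.zero) ()
  off-middle (Fin.suc (Fin.suc Fin.zero)) ()
  off-middle (Fin.suc (Fin.suc (Fin.suc Fin.zero))) ()

  agree : ∀ i → hybrid (Lstarstar (4 + m) j) (Lstar (4 + m) j) k (frame m i) ≡ Lstar 4 j i
  agree i = trans
    (hybrid-off-middle j k (frame m i) (subst (_≢ middle) (sym (frame-role m i)) (off-middle i)))
    (cong (starOrd j) (frame-role m i))

L3-unchanged : ∀ j (i : Fin 3) → Lstar 3 j i ≡ Lstarstar 3 j i
L3-unchanged j Fin.zero = refl
L3-unchanged j (Fin.suc Fin.zero) = refl
L3-unchanged j (Fin.suc (Fin.suc Fin.zero)) = refl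

mainTheorem7 : (n : ℕ) → 3 ≤ n → (g : Rule n) → StrategyProof g →
    (j : Fin 4) (np* : NP (Lstar n j)) (np** : NP (Lstarstar n j)) →
    g (Lstarstar n j) np** ≡ x → g (Lstar n j) np* ≡ x
mainTheorem7 (suc zero) (s≤s ())
mainTheorem7 (suc (suc zero)) (s≤s (s≤s ()))
mainTheorem7 (suc (suc (suc zero))) _ g sp j np* np** chosen =
  trans (sym (pointwise-outcome np** np* (L3-unchanged j))) chosen
  where open StrategyProofRule g sp
mainTheorem7 (suc (suc (suc (suc m)))) _ g sp j np* np** chosen =
  monotonicity (λ i → starstar-change j (role (4 + m) i)) (hybrid-NP m j) np* chosen
  where open Monotonicity g sp
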